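{- For all positive integers $m,n$, the number $C(m,n)$ of closed paths in the $m\times n$ plane grid with mirror boundary satisfies $C(m,n)=\gcd(m,n)-1$.
   Context: The $m\times n$ plane grid has point set $\{0,1,\dots,m\}\times\{0,1,\dots,n\}\subset\mathbb{Z}^2$; it consists of $mn$ unit squares, each with $2$ diagonals, so $2mn$ unit diagonals in total. The boundary of the rectangle $[0,m]\times[0,n]$ consists of mirrors. A beam of light travels along unit diagonals from grid point to grid point: at each step each coordinate changes by $+1$ or $-1$, and a coordinate reverses its direction of change exactly when it reaches $0$ or its maximum value ($m$, resp. $n$) (reflection in the mirror). The trajectories of such beams partition the set of all $2mn$ unit diagonals. A trajectory that passes through a corner (vertex) of the rectangle runs from one corner to another corner and is called an open path; every other trajectory is periodic and is called a closed path. $C(m,n)$ denotes the number of closed paths. -}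

module Defs where

open import Data.Nat using (ℕ; zero; suc; _∸_; _<_; _≡ᵇ_)
open import Data.Bool using (Bool; true; false; if_then_else_; _xor_)
open import Data.Product using (Σ; ∃; _×_; _,_)
open import Data.Sum using (_⊎_)
open import Data.Fin using (Fin)
open import Relation.Binary.PropositionalEquality using (_≡_)
open import Relation.Nullary using (¬_)

-- A unit diagonal of the m × n grid: (i , j , k) with i < m, j < n
-- denotes a diagonal of the unit square [i,i+1] × [j,j+1];
-- k = false : the diagonal from (i , j) to (i+1 , j+1),
-- k = true  : the diagonal from (i+1 , j) to (i , j+1).
Diagonal : Set
Diagonal = ℕ × ℕ × Bool

IsDiagonal : ℕ → ℕ → Diagonal → Set
IsDiagonal m n (i , j , _) = (i < m) × (j < n)

-- Beam state: current grid point (x , y) and the direction of the next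
-- step in each coordinate (true = +1, false = -1).
State : Set
State = ℕ × ℕ × Bool × Bool

move : Bool → ℕ → ℕ
move true  x = suc x
move false x = x ∸ 1

reflect : ℕ → ℕ → Bool → Bool
reflect M x' d = if x' ≡ᵇ M then false else (if x' ≡ᵇ 0 then true else d)

step : ℕ → ℕ → State → State
step m n (x , y , dx , dy) =
  let x' = move dx x ; y' = move dy y in
  (x' , y' , reflect m x' dx , reflect n y' dy)

iterate : ℕ → (State → State) → State → State
iterate zero    f s = s
iterate (suc t) f s = f (iterate t f s)

diagonalOf : State → Diagonal
diagonalOf (x , y , dx , dy) =
  ( (if dx then x else x ∸ 1)
  , (if dy then y else y ∸ 1)
  , dx xor dy )

start : Diagonal → State
start (i , j , false) = (i , j , true , true)
start (i , j , true)  = (suc i , j , false , true)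

SameTrajectory : ℕ → ℕ → Diagonal → Diagonal → Set
SameTrajectory m n d e = ∃ λ t → diagonalOf (iterate t (step m n) (start d)) ≡ e

AtCorner : ℕ → ℕ → State → Set
AtCorner m n (x , y , _ , _) = ((x ≡ 0) ⊎ (x ≡ m)) × ((y ≡ 0) ⊎ (y ≡ n))

-- the trajectory through d is a closed path: it never passes through a corner
OnClosedPath : ℕ → ℕ → Diagonal → Set
OnClosedPath m n d = ∀ t → ¬ AtCorner m n (iterate t (step m n) (start d))

-- C(m,n) = c : the closed paths (trajectories) are exactly c in number,
-- witnessed by c representative diagonals lying on pairwise distinct
-- closed trajectories that together cover every diagonal on a closed path.
ClosedPathCount : ℕ → ℕ → ℕ → Set
ClosedPathCount m n c =
  Σ (Fin c → Diagonal) λ r →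
    (∀ a → IsDiagonal m n (r a) × OnClosedPath m n (r a))
  × (∀ a b → SameTrajectory m n (r a) (r b) → a ≡ b)
  × (∀ d → IsDiagonal m n d → OnClosedPath m n d → ∃ λ a → SameTrajectory m n (r a) d)

{-# OPTIONS --safe #-}
module Submission where

-- Unfolding the mirrors: a coordinate in [0, m] moving by ±1 and reflected at 0 and m is the
-- image of a point X of ℤ/2m moving by +1 under the folding X ↦ min (X, 2m − X).  A beam state
-- is therefore a pair (X, Y) in ℤ/2m × ℤ/2n, and a step adds (1, 1).  Since gcd (2m) (2n) = 2g
-- with g = gcd m n, the Chinese remainder theorem says that two pairs lie on the same orbit iff
-- they have the same class X − Y mod 2g.  The corners are the pairs with X ∈ {0, m} and
-- Y ∈ {0, n}; as m/g and n/g are not both even, their classes are exactly the multiples of g.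
-- The two beam states crossing a diagonal in opposite directions have opposite classes, so the
-- closed paths correspond to the pairs {c, 2g − c} with 0 < c < g, the one for c containing the
-- diagonal from (c, 0) to (c + 1, 1).

open import Defs
open import Data.Bool using (Bool; true; false; not; T; if_then_else_)
open import Data.Bool.Properties using (not-¬; not-distribˡ-xor; not-distribʳ-xor)
open import Data.Fin using (Fin; toℕ; fromℕ<)
open import Data.Fin.Properties using (toℕ<n; toℕ-fromℕ<; toℕ-injective)
open import Data.Nat
open import Data.Nat.DivMod
  using (_%_; _/_; m≡m%n+[m/n]*n; m<n⇒m%n≡m; m%n<n; [m+kn]%n≡m%n; n%n≡0; %-distribˡ-+; m%n%n≡m%n)
open import Data.Nat.Divisibility
  using (_∣_; divides; _∣?_; _∣0; ∣-refl; *-monoʳ-∣; ∣⇒≤; ∣m+n∣m⇒∣n; ∣m∣n⇒∣m+n; m∣m*n; n∣m*n)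
open import Data.Nat.GCD
  using (gcd; gcd-GCD; module Bézout; gcd[m,n]∣m; gcd[m,n]∣n; gcd[m,n]≢0; gcd-greatest;
         c*gcd[m,n]≡gcd[cm,cn])
open import Data.Nat.Properties
open import Data.Nat.Tactic.RingSolver using (solve-∀)
open import Data.Product using (∃; ∃₂; _×_; _,_; proj₁; proj₂)
open import Data.Sum using (_⊎_; inj₁; inj₂)
open import Function using (_∘_)
open import Level using (0ℓ)
open import Relation.Binary.Bundles using (Setoid)
open import Relation.Binary.Definitions using (tri<; tri≈; tri>)
open import Relation.Binary.PropositionalEquality
import Relation.Binary.Reasoning.Setoid
open import Relation.Binary.Structures using (IsEquivalence)
open import Relation.Nullary using (¬_; Dec; yes; no; contradiction)

-- Congruences

infix 4 _≡_mod_
_≡_mod_ : ℕ → ℕ → ℕ → Set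
x ≡ y mod k = ∃₂ λ a b → x + a * k ≡ y + b * k

module _ {k : ℕ} where

  mod-reflexive : ∀ {x y} → x ≡ y → x ≡ y mod k
  mod-reflexive refl = 0 , 0 , refl

  mod-refl : ∀ {x} → x ≡ x mod k
  mod-refl = mod-reflexive refl

  mod-sym : ∀ {x y} → x ≡ y mod k → y ≡ x mod k
  mod-sym (a , b , e) = b , a , sym e

  mod-trans : ∀ {x y z} → x ≡ y mod k → y ≡ z mod k → x ≡ z mod k
  mod-trans {x} {y} {z} (a , b , x≡y) (c , d , y≡z) = a + c , b + d , (begin
    x + (a + c) * k       ≡⟨ shift x a c k ⟩
    (x + a * k) + c * k   ≡⟨ cong (_+ c * k) x≡y ⟩
    (y + b * k) + c * k   ≡⟨ swap y b c k ⟩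
    (y + c * k) + b * k   ≡⟨ cong (_+ b * k) y≡z ⟩
    (z + d * k) + b * k   ≡⟨ swap z d b k ⟩
    (z + b * k) + d * k   ≡⟨ shift z b d k ⟨
    z + (b + d) * k       ∎)
    where
    open ≡-Reasoning
    shift : ∀ x a c k → x + (a + c) * k ≡ (x + a * k) + c * k
    shift = solve-∀
    swap : ∀ y b c k → (y + b * k) + c * k ≡ (y + c * k) + b * k
    swap = solve-∀

  mod-isEquivalence : IsEquivalence (λ x y → x ≡ y mod k)
  mod-isEquivalence = record { refl = mod-refl ; sym = mod-sym ; trans = mod-trans }

  mod-setoid : Setoid 0ℓ 0ℓ
  mod-setoid = record { isEquivalence = mod-isEquivalence }

  +-cong-mod : ∀ {x y u v} → x ≡ y mod k → u ≡ v mod k → x + u ≡ y + v mod k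
  +-cong-mod {x} {y} {u} {v} (a , b , x≡y) (c , d , u≡v) = a + c , b + d , (begin
    (x + u) + (a + c) * k       ≡⟨ regroup x u a c k ⟩
    (x + a * k) + (u + c * k)   ≡⟨ cong₂ _+_ x≡y u≡v ⟩
    (y + b * k) + (v + d * k)   ≡⟨ regroup y v b d k ⟨
    (y + v) + (b + d) * k       ∎)
    where
    open ≡-Reasoning
    regroup : ∀ x u a c k → (x + u) + (a + c) * k ≡ (x + a * k) + (u + c * k)
    regroup = solve-∀

  +-congˡ-mod : ∀ z {x y} → x ≡ y mod k → z + x ≡ z + y mod k
  +-congˡ-mod z = +-cong-mod (mod-refl {z})

  +-congʳ-mod : ∀ z {x y} → x ≡ y mod k → x + z ≡ y + z mod k
  +-congʳ-mod z x≡y = +-cong-mod x≡y (mod-refl {z})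

  *-congˡ-mod : ∀ c {x y} → x ≡ y mod k → c * x ≡ c * y mod k
  *-congˡ-mod c {x} {y} (a , b , x≡y) = c * a , c * b , (begin
    c * x + c * a * k   ≡⟨ distrib c x a k ⟩
    c * (x + a * k)     ≡⟨ cong (c *_) x≡y ⟩
    c * (y + b * k)     ≡⟨ distrib c y b k ⟨
    c * y + c * b * k   ∎)
    where
    open ≡-Reasoning
    distrib : ∀ c x a k → c * x + c * a * k ≡ c * (x + a * k)
    distrib = solve-∀

  +-cancelʳ-mod : ∀ {x y} z → x + z ≡ y + z mod k → x ≡ y mod k
  +-cancelʳ-mod {x} {y} z (a , b , e) = a , b , +-cancelʳ-≡ z _ _ (begin
    x + a * k + z   ≡⟨ swap x a k z ⟩
    x + z + a * k   ≡⟨ e ⟩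
    y + z + b * k   ≡⟨ swap y b k z ⟨
    y + b * k + z   ∎)
    where
    open ≡-Reasoning
    swap : ∀ x a k z → x + a * k + z ≡ x + z + a * k
    swap = solve-∀

  multiple-mod : ∀ x c → x + c * k ≡ x mod k
  multiple-mod x c = 0 , c , +-identityʳ _

  ∣⇒≡0-mod : ∀ {x} → k ∣ x → x ≡ 0 mod k
  ∣⇒≡0-mod {x} (divides q x≡q*k) = 0 , q , trans (+-identityʳ x) x≡q*k

  ∣-resp-mod : ∀ {x y} → x ≡ y mod k → k ∣ x → k ∣ y
  ∣-resp-mod {x} {y} (a , b , e) k∣x =
    ∣m+n∣m⇒∣n (subst (k ∣_) (trans e (+-comm y (b * k))) (∣m∣n⇒∣m+n k∣x (n∣m*n a))) (n∣m*n b)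

  mod-divisor : ∀ {d x y} → d ∣ k → x ≡ y mod k → x ≡ y mod d
  mod-divisor {d} {x} {y} (divides q k≡q*d) (a , b , e) = a * q , b * q , (begin
    x + a * q * d   ≡⟨ cong (x +_) (*-assoc a q d) ⟩
    x + a * (q * d) ≡⟨ cong (λ k → x + a * k) k≡q*d ⟨
    x + a * k       ≡⟨ e ⟩
    y + b * k       ≡⟨ cong (λ k → y + b * k) k≡q*d ⟩
    y + b * (q * d) ≡⟨ cong (y +_) (*-assoc b q d) ⟨
    y + b * q * d   ∎)
    where open ≡-Reasoning

  module _ .{{_ : NonZero k}} where

    mod-<⇒≡ : ∀ {x y} → x < k → y < k → x ≡ y mod k → x ≡ y
    mod-<⇒≡ {x} {y} x<k y<k (a , b , e) = begin
      x               ≡⟨ m<n⇒m%n≡m x<k ⟨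
      x % k           ≡⟨ [m+kn]%n≡m%n x a k ⟨
      (x + a * k) % k ≡⟨ cong (_% k) e ⟩
      (y + b * k) % k ≡⟨ [m+kn]%n≡m%n y b k ⟩
      y % k           ≡⟨ m<n⇒m%n≡m y<k ⟩
      y               ∎
      where open ≡-Reasoning

    %-mod : ∀ x → x % k ≡ x mod k
    %-mod x = x / k , 0 , trans (sym (m≡m%n+[m/n]*n x k)) (sym (+-identityʳ x))

    complement-mod : ∀ x → ∃ λ w → x + w ≡ 0 mod k
    complement-mod x = x * pred k , 0 , x , (begin
      x + x * pred k + 0   ≡⟨ +-identityʳ _ ⟩
      x + x * pred k       ≡⟨ *-suc x (pred k) ⟨
      x * suc (pred k)     ≡⟨ cong (x *_) (suc-pred k) ⟩
      x * k                ∎)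
      where open ≡-Reasoning

module ≡-mod-Reasoning (k : ℕ) = Relation.Binary.Reasoning.Setoid (mod-setoid {k})

module _ (k : ℕ) .{{_ : NonZero k}} where

  open ≡-mod-Reasoning k

  shift-exists : ∀ X Y → ∃ λ c → c < k × X ≡ c + Y mod k
  shift-exists X Y = (X + w) % k , m%n<n (X + w) k , mod-sym (begin
    (X + w) % k + Y   ≈⟨ +-congʳ-mod Y (%-mod (X + w)) ⟩
    X + w + Y         ≡⟨ swap X w Y ⟩
    X + (Y + w)       ≈⟨ +-congˡ-mod X Y+w≡0 ⟩
    X + 0             ≡⟨ +-identityʳ X ⟩
    X                 ∎)
    where
    w : ℕ
    w = proj₁ (complement-mod {k} Y)
    Y+w≡0 : Y + w ≡ 0 mod k
    Y+w≡0 = proj₂ (complement-mod {k} Y)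
    swap : ∀ X w Y → X + w + Y ≡ X + (Y + w)
    swap = solve-∀

  shift-unique : ∀ {X Y c c′} → c < k → c′ < k → X ≡ c + Y mod k → X ≡ c′ + Y mod k → c ≡ c′
  shift-unique {Y = Y} c<k c′<k X≡c+Y X≡c′+Y =
    mod-<⇒≡ c<k c′<k (+-cancelʳ-mod Y (mod-trans (mod-sym X≡c+Y) X≡c′+Y))

multiple-parity : ∀ {g k} → g ∣ k → 2 * g ∣ k ⊎ k ≡ g mod 2 * g
multiple-parity {g} {k} (divides q k≡q*g) with q % 2 | m≡m%n+[m/n]*n q 2 | m%n<n q 2
... | 0 | q≡ | _ =
  inj₁ (divides (q / 2) (trans k≡q*g (trans (cong (_* g) q≡) (*-assoc (q / 2) 2 g))))
... | 1 | q≡ | _ = inj₂ (0 , q / 2 , (begin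
  k + 0 * (2 * g)         ≡⟨ +-identityʳ k ⟩
  k                       ≡⟨ k≡q*g ⟩
  q * g                   ≡⟨ cong (_* g) q≡ ⟩
  (1 + q / 2 * 2) * g     ≡⟨ odd (q / 2) g ⟩
  g + q / 2 * (2 * g)     ∎))
  where
  open ≡-Reasoning
  odd : ∀ r g → (1 + r * 2) * g ≡ g + r * (2 * g)
  odd = solve-∀
... | 2+ _ | _ | s≤s (s≤s ())

-- The Chinese remainder theorem

crt-from-bézout : ∀ M N x y {d u v} .{{_ : NonZero N}} → d + y * N ≡ x * M →
                  u ≡ v mod d → ∃ λ t → t ≡ u mod M × t ≡ v mod N
crt-from-bézout M N x y {d} {u} {v} bézout (a , b , u≡v) =
  u + (a + w) * x * M , multiple-mod u ((a + w) * x) , (begin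
    u + (a + w) * x * M     ≡⟨ cong (u +_) (*-assoc (a + w) x M) ⟩
    u + (a + w) * (x * M)   ≈⟨ +-congˡ-mod u (*-congˡ-mod (a + w) xM≡d) ⟩
    u + (a + w) * d         ≡⟨ split u a w d ⟩
    (u + a * d) + w * d     ≡⟨ cong (_+ w * d) u≡v ⟩
    (v + b * d) + w * d     ≡⟨ join v b w d ⟩
    v + d * (b + w)         ≈⟨ +-congˡ-mod v (*-congˡ-mod d b+w≡0) ⟩
    v + d * 0               ≡⟨ cong (v +_) (*-zeroʳ d) ⟩
    v + 0                   ≡⟨ +-identityʳ v ⟩
    v                       ∎)
  where
  open ≡-mod-Reasoning N
  w : ℕ
  w = proj₁ (complement-mod {N} b)
  b+w≡0 : b + w ≡ 0 mod N
  b+w≡0 = proj₂ (complement-mod {N} b)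
  xM≡d : x * M ≡ d mod N
  xM≡d = 0 , y , trans (+-identityʳ (x * M)) (sym bézout)
  split : ∀ u a w d → u + (a + w) * d ≡ (u + a * d) + w * d
  split = solve-∀
  join : ∀ v b w d → (v + b * d) + w * d ≡ v + d * (b + w)
  join = solve-∀

crt : ∀ M N .{{_ : NonZero M}} .{{_ : NonZero N}} {u v} →
      u ≡ v mod gcd M N → ∃ λ t → t ≡ u mod M × t ≡ v mod N
crt M N u≡v with Bézout.identity (gcd-GCD M N)
... | Bézout.+- x y eq = crt-from-bézout M N x y eq u≡v
... | Bézout.-+ x y eq =
  let t , t≡v , t≡u = crt-from-bézout N M y x eq (mod-sym u≡v) in t , t≡u , t≡v

-- Shifting both targets by one w with u₀ + v₀ + w ≡ 0 (mod M N) reduces this to the plain CRT.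
crt-shifted : ∀ M N .{{_ : NonZero M}} .{{_ : NonZero N}} {u₀ v₀ u v} →
              u₀ + v ≡ v₀ + u mod gcd M N → ∃ λ t → u₀ + t ≡ u mod M × v₀ + t ≡ v mod N
crt-shifted M N {u₀} {v₀} {u} {v} shifts≡ =
  let t , t≡u+v₀+w , t≡v+u₀+w = crt M N targets≡ in
  t , mod-trans (+-congˡ-mod u₀ t≡u+v₀+w) (absorb u₀ v₀ (mod-divisor (m∣m*n N) u₀+v₀+w≡0)) ,
      mod-trans (+-congˡ-mod v₀ t≡v+u₀+w) (absorb v₀ u₀ (mod-divisor (n∣m*n M) v₀+u₀+w≡0))
  where
  instance
    MN≢0 : NonZero (M * N)
    MN≢0 = m*n≢0 M N
  w : ℕ
  w = proj₁ (complement-mod {M * N} (u₀ + v₀))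
  u₀+v₀+w≡0 : u₀ + v₀ + w ≡ 0 mod M * N
  u₀+v₀+w≡0 = proj₂ (complement-mod {M * N} (u₀ + v₀))
  v₀+u₀+w≡0 : v₀ + u₀ + w ≡ 0 mod M * N
  v₀+u₀+w≡0 = mod-trans (mod-reflexive (cong (_+ w) (+-comm v₀ u₀))) u₀+v₀+w≡0
  targets≡ : u + v₀ + w ≡ v + u₀ + w mod gcd M N
  targets≡ = +-congʳ-mod w (mod-trans (mod-reflexive (+-comm u v₀))
                           (mod-trans (mod-sym shifts≡) (mod-reflexive (+-comm u₀ v))))
  absorb : ∀ {K b} a c → a + c + w ≡ 0 mod K → a + (b + c + w) ≡ b mod K
  absorb {K} {b} a c a+c+w≡0 = begin
    a + (b + c + w)   ≡⟨ swap a b c w ⟩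
    b + (a + c + w)   ≈⟨ +-congˡ-mod b a+c+w≡0 ⟩
    b + 0             ≡⟨ +-identityʳ b ⟩
    b                 ∎
    where
    open ≡-mod-Reasoning K
    swap : ∀ a b c w → a + (b + c + w) ≡ b + (a + c + w)
    swap = solve-∀

-- Unfolding the reflections

[1+m%n]%n≡[1+m]%n : ∀ a k .{{_ : NonZero k}} → suc (a % k) % k ≡ suc a % k
[1+m%n]%n≡[1+m]%n a k = begin
  (1 + a % k) % k          ≡⟨ %-distribˡ-+ 1 (a % k) k ⟩
  (1 % k + a % k % k) % k  ≡⟨ cong (λ b → (1 % k + b) % k) (m%n%n≡m%n a k) ⟩
  (1 % k + a % k) % k      ≡⟨ %-distribˡ-+ 1 a k ⟨
  (1 + a) % k              ∎
  where open ≡-Reasoning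

2*n≡n+n : ∀ n → 2 * n ≡ n + n
2*n≡n+n n = cong (n +_) (+-identityʳ n)

n<2*n : ∀ n .{{_ : NonZero n}} → n < 2 * n
n<2*n n = subst (n <_) (sym (2*n≡n+n n)) (m<m+n n (>-nonZero⁻¹ n))

+-<-2* : ∀ {M x X} → x ≤ M → X < M → x + X < 2 * M
+-<-2* {M} {x} {X} x≤M X<M = subst (x + X <_) (sym (2*n≡n+n M)) (+-mono-≤-< x≤M X<M)

reflect-at-max : ∀ M d → reflect M M d ≡ false
reflect-at-max M d with M ≡ᵇ M | ≡⇒≡ᵇ M M refl
... | true  | _ = refl

reflect-at-0 : ∀ M .{{_ : NonZero M}} d → reflect M 0 d ≡ true
reflect-at-0 (suc M) d = refl

reflect-inside : ∀ {M x} d → 0 < x → x < M → reflect M x d ≡ d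
reflect-inside {M} {suc x} d _ x<M with suc x ≡ᵇ M in x≡ᵇM
... | true  = contradiction (≡ᵇ⇒≡ (suc x) M (subst T (sym x≡ᵇM) _)) (<⇒≢ x<M)
... | false = refl

data Unfolded (M : ℕ) : ℕ → ℕ → Bool → Set where
  ascending  : ∀ {X} → X < M → Unfolded M X X true
  descending : ∀ {X x} → 0 < x → x ≤ M → x + X ≡ 2 * M → Unfolded M X x false

unfolded-< : ∀ {M X x d} → Unfolded M X x d → X < 2 * M
unfolded-< {M} (ascending X<M) = <-≤-trans X<M (m≤n*m M 2)
unfolded-< {M} {X} (descending 0<x _ x+X≡2M) = subst (X <_) x+X≡2M (+-monoˡ-≤ X 0<x)

unfolded-functional : ∀ {M X x x′ d d′} → Unfolded M X x d → Unfolded M X x′ d′ →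
                      x ≡ x′ × d ≡ d′
unfolded-functional (ascending _) (ascending _) = refl , refl
unfolded-functional (ascending X<M) (descending _ x≤M x+X≡2M) =
  contradiction x+X≡2M (<⇒≢ (+-<-2* x≤M X<M))
unfolded-functional (descending _ x≤M x+X≡2M) (ascending X<M) =
  contradiction x+X≡2M (<⇒≢ (+-<-2* x≤M X<M))
unfolded-functional {X = X} (descending _ _ x+X≡2M) (descending _ _ x′+X≡2M) =
  +-cancelʳ-≡ X _ _ (trans x+X≡2M (sym x′+X≡2M)) , refl

module _ {M : ℕ} .{{_ : NonZero M}} where

  private instance
    2M≢0 : NonZero (2 * M)
    2M≢0 = m*n≢0 2 M

  unfolded-% : ∀ {X x d} → Unfolded M X x d → Unfolded M (X % (2 * M)) x d
  unfolded-% u = subst (λ X → Unfolded M X _ _) (sym (m<n⇒m%n≡m (unfolded-< u))) u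

  unfolded-step : ∀ {X x d} → Unfolded M X x d →
                  Unfolded M (suc X % (2 * M)) (move d x) (reflect M (move d x) d)
  unfolded-step {X} (ascending X<M) with m≤n⇒m<n∨m≡n X<M
  ... | inj₁ 1+X<M rewrite reflect-inside true z<s 1+X<M = unfolded-% (ascending 1+X<M)
  ... | inj₂ refl  rewrite reflect-at-max M true =
    unfolded-% (descending z<s ≤-refl (sym (2*n≡n+n M)))
  unfolded-step (descending {x = suc zero} _ _ 1+X≡2M) rewrite reflect-at-0 M false =
    subst (λ X → Unfolded M X 0 true) (sym (trans (cong (_% (2 * M)) 1+X≡2M) (n%n≡0 (2 * M))))
          (ascending (>-nonZero⁻¹ M))
  unfolded-step {X} (descending {x = suc (suc x)} _ 2+x≤M 2+x+X≡2M)
    rewrite reflect-inside false z<s 2+x≤M =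
    unfolded-% (descending z<s (<⇒≤ 2+x≤M) (trans (+-suc (suc x) X) 2+x+X≡2M))

unfolded-reverse : ∀ {M X x d} → Unfolded M X x d →
                   ∃ λ X′ → suc (X + X′) ≡ 2 * M × Unfolded M X′ (move d x) (not d)
unfolded-reverse {M} {X} (ascending X<M) =
  2 * M ∸ suc X , 1+X+X′≡2M , descending z<s X<M 1+X+X′≡2M
  where
  1+X+X′≡2M : suc X + (2 * M ∸ suc X) ≡ 2 * M
  1+X+X′≡2M = m+[n∸m]≡n (<-≤-trans X<M (m≤n*m M 2))
unfolded-reverse {X = X} (descending {x = suc x} _ 1+x≤M 1+x+X≡2M) =
  x , trans (cong suc (+-comm X x)) 1+x+X≡2M , ascending 1+x≤M

edge : Bool → ℕ → ℕ
edge d x = if d then x else x ∸ 1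

unfolded-same-edge : ∀ {M X X′ x x′ d d′} → Unfolded M X x d → Unfolded M X′ x′ d′ →
                     edge d x ≡ edge d′ x′ →
                     (d ≡ d′ × X ≡ X′) ⊎ (d ≡ not d′ × suc (X + X′) ≡ 2 * M)
unfolded-same-edge (ascending _) (ascending _) X≡X′ = inj₁ (refl , X≡X′)
unfolded-same-edge {M} {X′ = X′} (ascending _) (descending {x = suc x} _ _ 1+x+X′≡2M) X≡x =
  inj₂ (refl , subst (λ X → suc (X + X′) ≡ 2 * M) (sym X≡x) 1+x+X′≡2M)
unfolded-same-edge {M} {X} (descending {x = suc x} _ _ 1+x+X≡2M) (ascending _) x≡X′ =
  inj₂ (refl , subst (λ X′ → suc (X + X′) ≡ 2 * M) x≡X′ (trans (cong suc (+-comm X x)) 1+x+X≡2M))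
unfolded-same-edge {X = X} {X′}
  (descending {x = suc x} _ _ 1+x+X≡2M) (descending {x = suc x′} _ _ 1+x′+X′≡2M) x≡x′ =
  inj₁ (refl , +-cancelˡ-≡ (suc x) X X′ (trans 1+x+X≡2M (sym 1+x+X′≡2M′)))
  where
  1+x+X′≡2M′ : suc x + X′ ≡ _
  1+x+X′≡2M′ = subst (λ x → suc x + X′ ≡ _) (sym x≡x′) 1+x′+X′≡2M

Wall : ℕ → ℕ → Set
Wall M x = x ≡ 0 ⊎ x ≡ M

wall-< : ∀ {M X} .{{_ : NonZero M}} → Wall M X → X < 2 * M
wall-< {M} (inj₁ refl) = ≤-<-trans z≤n (n<2*n M)
wall-< {M} (inj₂ refl) = n<2*n M

unfolded-wall : ∀ {M X x d} → Unfolded M X x d → Wall M x → Wall M X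
unfolded-wall (ascending _) atWall = atWall
unfolded-wall (descending () _ _) (inj₁ refl)
unfolded-wall {M} {X} (descending _ _ M+X≡2M) (inj₂ refl) =
  inj₂ (+-cancelˡ-≡ M X M (trans M+X≡2M (2*n≡n+n M)))

unfolded-wall⁻¹ : ∀ {M X x d} → Unfolded M X x d → Wall M X → Wall M x
unfolded-wall⁻¹ (ascending _) atWall = atWall
unfolded-wall⁻¹ (descending 0<x x≤M x+0≡2M) (inj₁ refl) =
  contradiction x+0≡2M (<⇒≢ (+-<-2* x≤M (<-≤-trans 0<x x≤M)))
unfolded-wall⁻¹ {M} (descending {x = x} _ _ x+M≡2M) (inj₂ refl) =
  inj₂ (+-cancelʳ-≡ M x M (trans x+M≡2M (2*n≡n+n M)))

reverse : State → State
reverse (x , y , dx , dy) = (move dx x , move dy y , not dx , not dy)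

diagonalOf-reverse : ∀ s → diagonalOf (reverse s) ≡ diagonalOf s
diagonalOf-reverse (x , y , true  , true)  = refl
diagonalOf-reverse (x , y , true  , false) = refl
diagonalOf-reverse (x , y , false , true)  = refl
diagonalOf-reverse (x , y , false , false) = refl

diagonalOf-start : ∀ d → diagonalOf (start d) ≡ d
diagonalOf-start (i , j , false) = refl
diagonalOf-start (i , j , true)  = refl

Unfolded² : ℕ → ℕ → ℕ → ℕ → State → Set
Unfolded² m n X Y (x , y , dx , dy) = Unfolded m X x dx × Unfolded n Y y dy

module _ {m n : ℕ} where

  unfolded²-functional : ∀ {X Y} s s′ → Unfolded² m n X Y s → Unfolded² m n X Y s′ → s ≡ s′
  unfolded²-functional _ _ (ux , uy) (ux′ , uy′)
    with unfolded-functional ux ux′ | unfolded-functional uy uy′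
  ... | refl , refl | refl , refl = refl

  unfolded²-wall : ∀ {X Y} s → Unfolded² m n X Y s → AtCorner m n s → Wall m X × Wall n Y
  unfolded²-wall _ (ux , uy) (wx , wy) = unfolded-wall ux wx , unfolded-wall uy wy

  unfolded²-wall⁻¹ : ∀ {X Y} s → Unfolded² m n X Y s → Wall m X → Wall n Y → AtCorner m n s
  unfolded²-wall⁻¹ _ (ux , uy) wx wy = unfolded-wall⁻¹ ux wx , unfolded-wall⁻¹ uy wy

  unfolded²-start : ∀ d → IsDiagonal m n d → ∃₂ λ X Y → Unfolded² m n X Y (start d)
  unfolded²-start (i , j , false) (i<m , j<n) = i , j , ascending i<m , ascending j<n
  unfolded²-start (i , j , true)  (i<m , j<n) =
    let X , _ , ux = unfolded-reverse (ascending i<m) in X , j , ux , ascending j<n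

  unfolded²-reverse : ∀ {X Y} s → Unfolded² m n X Y s →
                      ∃₂ λ X′ Y′ → suc (X + X′) ≡ 2 * m × suc (Y + Y′) ≡ 2 * n
                                 × Unfolded² m n X′ Y′ (reverse s)
  unfolded²-reverse _ (ux , uy) =
    let X′ , 1+X+X′≡2m , ux′ = unfolded-reverse ux
        Y′ , 1+Y+Y′≡2n , uy′ = unfolded-reverse uy
    in X′ , Y′ , 1+X+X′≡2m , 1+Y+Y′≡2n , ux′ , uy′

  unfolded²-same-diagonal :
    ∀ {X Y X′ Y′} s s′ → Unfolded² m n X Y s → Unfolded² m n X′ Y′ s′ →
    diagonalOf s ≡ diagonalOf s′ →
    (X ≡ X′ × Y ≡ Y′) ⊎ (suc (X + X′) ≡ 2 * m × suc (Y + Y′) ≡ 2 * n)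
  unfolded²-same-diagonal (_ , _ , dx , dy) (_ , _ , dx′ , dy′) (ux , uy) (ux′ , uy′) same
    with unfolded-same-edge ux ux′ (cong proj₁ same)
       | unfolded-same-edge uy uy′ (cong (proj₁ ∘ proj₂) same)
  ... | inj₁ (_ , X≡X′) | inj₁ (_ , Y≡Y′) = inj₁ (X≡X′ , Y≡Y′)
  ... | inj₂ (_ , 1+X+X′≡2m) | inj₂ (_ , 1+Y+Y′≡2n) = inj₂ (1+X+X′≡2m , 1+Y+Y′≡2n)
  ... | inj₁ (refl , _) | inj₂ (refl , _) =
    contradiction (trans (not-distribʳ-xor dx dy′) (cong (proj₂ ∘ proj₂) same)) (not-¬ refl ∘ sym)
  ... | inj₂ (refl , _) | inj₁ (refl , _) =
    contradiction (trans (not-distribˡ-xor dx′ dy) (cong (proj₂ ∘ proj₂) same)) (not-¬ refl ∘ sym)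

module _ {m n : ℕ} .{{_ : NonZero m}} .{{_ : NonZero n}} where

  private instance
    2m≢0 : NonZero (2 * m)
    2m≢0 = m*n≢0 2 m
    2n≢0 : NonZero (2 * n)
    2n≢0 = m*n≢0 2 n

  unfolded²-iterate :
    ∀ {X Y s} → Unfolded² m n X Y s → ∀ t →
    Unfolded² m n ((X + t) % (2 * m)) ((Y + t) % (2 * n)) (iterate t (step m n) s)
  unfolded²-iterate {X} {Y} (ux , uy) zero
    rewrite +-identityʳ X | +-identityʳ Y = unfolded-% ux , unfolded-% uy
  unfolded²-iterate {X} {Y} {s} u (suc t) with iterate t (step m n) s | unfolded²-iterate u t
  ... | _ | ux , uy rewrite +-suc X t | +-suc Y t
    = subst (λ X′ → Unfolded m X′ _ _) ([1+m%n]%n≡[1+m]%n (X + t) (2 * m)) (unfolded-step ux)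
    , subst (λ Y′ → Unfolded n Y′ _ _) ([1+m%n]%n≡[1+m]%n (Y + t) (2 * n)) (unfolded-step uy)

-- Counting closed paths

-- The unfolded coordinates (X, Y) have class c when X ≡ c + Y mod 2 * g, i.e. c ≡ X − Y.
module ClosedPaths (m n : ℕ) .{{_ : NonZero m}} .{{_ : NonZero n}} where

  g : ℕ
  g = gcd m n

  g∣m : g ∣ m
  g∣m = gcd[m,n]∣m m n

  g∣n : g ∣ n
  g∣n = gcd[m,n]∣n m n

  instance
    g≢0 : NonZero g
    g≢0 = ≢-nonZero (gcd[m,n]≢0 m n (inj₁ (≢-nonZero⁻¹ m)))

  private instance
    2m≢0 : NonZero (2 * m)
    2m≢0 = m*n≢0 2 m
    2n≢0 : NonZero (2 * n)
    2n≢0 = m*n≢0 2 n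
    2g≢0 : NonZero (2 * g)
    2g≢0 = m*n≢0 2 g

  open ≡-mod-Reasoning (2 * g) hiding (start)

  2g∣2m : 2 * g ∣ 2 * m
  2g∣2m = *-monoʳ-∣ 2 g∣m

  2g∣2n : 2 * g ∣ 2 * n
  2g∣2n = *-monoʳ-∣ 2 g∣n

  2g∸g≡g : 2 * g ∸ g ≡ g
  2g∸g≡g = trans (cong (_∸ g) (2*n≡n+n g)) (m+n∸m≡n g g)

  c+[2g∸c]≡0 : ∀ {c} → c ≤ 2 * g → c + (2 * g ∸ c) ≡ 0 mod 2 * g
  c+[2g∸c]≡0 c≤2g = mod-trans (mod-reflexive (m+[n∸m]≡n c≤2g)) (∣⇒≡0-mod ∣-refl)

  m≡g⊎n≡g : m ≡ g mod 2 * g ⊎ n ≡ g mod 2 * g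
  m≡g⊎n≡g with multiple-parity g∣m | multiple-parity g∣n
  ... | inj₂ m≡g  | _         = inj₁ m≡g
  ... | inj₁ _    | inj₂ n≡g  = inj₂ n≡g
  ... | inj₁ 2g∣m | inj₁ 2g∣n = contradiction (∣⇒≤ (gcd-greatest 2g∣m 2g∣n)) (<⇒≱ (n<2*n g))

  wall-∣ : ∀ {M X} → g ∣ M → Wall M X → g ∣ X
  wall-∣ _   (inj₁ refl) = g ∣0
  wall-∣ g∣M (inj₂ refl) = g∣M

  corner⇒g∣class : ∀ {X Y c} → Wall m X → Wall n Y → X ≡ c + Y mod 2 * g → g ∣ c
  corner⇒g∣class {X} {Y} {c} wx wy X≡c+Y =
    ∣m+n∣m⇒∣n (subst (g ∣_) (+-comm c Y) g∣c+Y) (wall-∣ g∣n wy)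
    where
    g∣c+Y : g ∣ c + Y
    g∣c+Y = ∣-resp-mod (mod-divisor (n∣m*n 2) X≡c+Y) (wall-∣ g∣m wx)

  g∣class⇒corner : ∀ {c} → g ∣ c → ∃₂ λ X Y → Wall m X × Wall n Y × X ≡ c + Y mod 2 * g
  g∣class⇒corner {c} g∣c with multiple-parity g∣c
  ... | inj₁ 2g∣c =
    0 , 0 , inj₁ refl , inj₁ refl ,
    mod-sym (mod-trans (mod-reflexive (+-identityʳ c)) (∣⇒≡0-mod 2g∣c))
  ... | inj₂ c≡g with m≡g⊎n≡g
  ...   | inj₁ m≡g =
    m , 0 , inj₂ refl , inj₁ refl ,
    mod-trans m≡g (mod-sym (mod-trans (mod-reflexive (+-identityʳ c)) c≡g))
  ...   | inj₂ n≡g = 0 , n , inj₁ refl , inj₂ refl , mod-sym (begin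
    c + n     ≈⟨ +-cong-mod c≡g n≡g ⟩
    g + g     ≡⟨ 2*n≡n+n g ⟨
    2 * g     ≈⟨ ∣⇒≡0-mod ∣-refl ⟩
    0         ∎)

  class-invariant : ∀ {X Y c} → X ≡ c + Y mod 2 * g →
                    ∀ t → (X + t) % (2 * m) ≡ c + (Y + t) % (2 * n) mod 2 * g
  class-invariant {X} {Y} {c} X≡c+Y t = begin
    (X + t) % (2 * m)     ≈⟨ mod-divisor 2g∣2m (%-mod (X + t)) ⟩
    X + t                 ≈⟨ +-congʳ-mod t X≡c+Y ⟩
    c + Y + t             ≡⟨ +-assoc c Y t ⟩
    c + (Y + t)           ≈⟨ +-congˡ-mod c (mod-divisor 2g∣2n (%-mod (Y + t))) ⟨
    c + (Y + t) % (2 * n) ∎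

  class-reachable : ∀ {X₀ Y₀ X₁ Y₁ c} → X₀ ≡ c + Y₀ mod 2 * g → X₁ ≡ c + Y₁ mod 2 * g →
                    X₁ < 2 * m → Y₁ < 2 * n →
                    ∃ λ t → (X₀ + t) % (2 * m) ≡ X₁ × (Y₀ + t) % (2 * n) ≡ Y₁
  class-reachable {X₀} {Y₀} {X₁} {Y₁} {c} X₀≡c+Y₀ X₁≡c+Y₁ X₁<2m Y₁<2n =
    let t , X₀+t≡X₁ , Y₀+t≡Y₁ = crt-shifted (2 * m) (2 * n) shifts
    in t , mod-<⇒≡ (m%n<n _ _) X₁<2m (mod-trans (%-mod (X₀ + t)) X₀+t≡X₁)
         , mod-<⇒≡ (m%n<n _ _) Y₁<2n (mod-trans (%-mod (Y₀ + t)) Y₀+t≡Y₁)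
    where
    swap : ∀ c Y₀ Y₁ → c + Y₀ + Y₁ ≡ Y₀ + (c + Y₁)
    swap = solve-∀
    shifts : X₀ + Y₁ ≡ Y₀ + X₁ mod gcd (2 * m) (2 * n)
    shifts = subst (X₀ + Y₁ ≡ Y₀ + X₁ mod_) (c*gcd[m,n]≡gcd[cm,cn] 2 m n) (begin
      X₀ + Y₁         ≈⟨ +-congʳ-mod Y₁ X₀≡c+Y₀ ⟩
      c + Y₀ + Y₁     ≡⟨ swap c Y₀ Y₁ ⟩
      Y₀ + (c + Y₁)   ≈⟨ +-congˡ-mod Y₀ X₁≡c+Y₁ ⟨
      Y₀ + X₁         ∎)

  reverse-class : ∀ {X Y X′ Y′ c c′} → suc (X + X′) ≡ 2 * m → suc (Y + Y′) ≡ 2 * n →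
                  X ≡ c + Y mod 2 * g → c + c′ ≡ 0 mod 2 * g → X′ ≡ c′ + Y′ mod 2 * g
  reverse-class {X} {Y} {X′} {Y′} {c} {c′} 1+X+X′≡2m 1+Y+Y′≡2n X≡c+Y c+c′≡0 = begin
    X′                ≡⟨ +-identityʳ X′ ⟨
    X′ + 0            ≈⟨ +-congˡ-mod X′ c+c′≡0 ⟨
    X′ + (c + c′)     ≡⟨ +-assoc X′ c c′ ⟨
    X′ + c + c′       ≈⟨ +-congʳ-mod c′ X′+c≡Y′ ⟩
    Y′ + c′           ≡⟨ +-comm Y′ c′ ⟩
    c′ + Y′           ∎
    where
    regroup : ∀ X′ c Y → X′ + c + suc Y ≡ suc (X′ + (c + Y))
    regroup = solve-∀
    X′+c≡Y′ : X′ + c ≡ Y′ mod 2 * g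
    X′+c≡Y′ = +-cancelʳ-mod (suc Y) (begin
      X′ + c + suc Y     ≡⟨ regroup X′ c Y ⟩
      suc (X′ + (c + Y)) ≈⟨ +-congˡ-mod 1 (+-congˡ-mod X′ X≡c+Y) ⟨
      suc (X′ + X)       ≡⟨ cong suc (+-comm X′ X) ⟩
      suc (X + X′)       ≡⟨ 1+X+X′≡2m ⟩
      2 * m              ≈⟨ ∣⇒≡0-mod 2g∣2m ⟩
      0                  ≈⟨ ∣⇒≡0-mod 2g∣2n ⟨
      2 * n              ≡⟨ 1+Y+Y′≡2n ⟨
      suc (Y + Y′)       ≡⟨ cong suc (+-comm Y Y′) ⟩
      suc (Y′ + Y)       ≡⟨ +-suc Y′ Y ⟨
      Y′ + suc Y         ∎)

  reach-class : ∀ {X₀ Y₀ X₁ Y₁ c s} → Unfolded² m n X₀ Y₀ s → X₀ ≡ c + Y₀ mod 2 * g →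
                X₁ ≡ c + Y₁ mod 2 * g → X₁ < 2 * m → Y₁ < 2 * n →
                ∃ λ t → Unfolded² m n X₁ Y₁ (iterate t (step m n) s)
  reach-class {s = s} u X₀≡c+Y₀ X₁≡c+Y₁ X₁<2m Y₁<2n =
    let t , X₀+t≡X₁ , Y₀+t≡Y₁ = class-reachable X₀≡c+Y₀ X₁≡c+Y₁ X₁<2m Y₁<2n
    in t , subst₂ (λ X Y → Unfolded² m n X Y (iterate t (step m n) s)) X₀+t≡X₁ Y₀+t≡Y₁
                  (unfolded²-iterate u t)

  g∣class⇒¬closed : ∀ {X Y c d} → Unfolded² m n X Y (start d) → X ≡ c + Y mod 2 * g →
                    g ∣ c → ¬ OnClosedPath m n d
  g∣class⇒¬closed {d = d} u X≡c+Y g∣c closed =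
    let X₁ , Y₁ , wx , wy , X₁≡c+Y₁ = g∣class⇒corner g∣c
        t , u₁ = reach-class u X≡c+Y X₁≡c+Y₁ (wall-< wx) (wall-< wy)
    in closed t (unfolded²-wall⁻¹ (iterate t (step m n) (start d)) u₁ wx wy)

  rep : ℕ → Diagonal
  rep c = (c , 0 , false)

  rep-isDiagonal : ∀ {c} → c < g → IsDiagonal m n (rep c)
  rep-isDiagonal c<g = <-≤-trans c<g (∣⇒≤ g∣m) , >-nonZero⁻¹ n

  rep-unfolded : ∀ {c} → c < g → Unfolded² m n c 0 (start (rep c))
  rep-unfolded c<g = let c<m , 0<n = rep-isDiagonal c<g in ascending c<m , ascending 0<n

  rep-class : ∀ c → c ≡ c + 0 mod 2 * g
  rep-class c = mod-reflexive (sym (+-identityʳ c))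

  rep-closed : ∀ {c} → 0 < c → c < g → OnClosedPath m n (rep c)
  rep-closed {c} 0<c c<g t atCorner =
    let u = unfolded²-iterate (rep-unfolded c<g) t
        wx , wy = unfolded²-wall (iterate t (step m n) (start (rep c))) u atCorner
    in <⇒≱ c<g (∣⇒≤ {{>-nonZero 0<c}} (corner⇒g∣class wx wy (class-invariant (rep-class c) t)))

  rep-reaches : ∀ {X Y c s} → c < g → Unfolded² m n X Y s → X ≡ c + Y mod 2 * g →
                SameTrajectory m n (rep c) (diagonalOf s)
  rep-reaches {s = s} c<g u@(ux , uy) X≡c+Y =
    let t , u₁ = reach-class (rep-unfolded c<g) (rep-class _) X≡c+Y (unfolded-< ux) (unfolded-< uy)
    in t , cong diagonalOf (unfolded²-functional _ s u₁ u)

  rep-distinct : ∀ {c c′} → c < g → 0 < c′ → c′ < g →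
                 SameTrajectory m n (rep c) (rep c′) → c ≡ c′
  rep-distinct {c} {c′} c<g 0<c′ c′<g (t , onDiagonal)
    with unfolded²-same-diagonal (start (rep c′)) (iterate t (step m n) (start (rep c)))
           (rep-unfolded c′<g) (unfolded²-iterate (rep-unfolded c<g) t) (sym onDiagonal)
  ... | inj₁ (c′≡X , 0≡Y) =
    shift-unique (2 * g) c<2g (<-trans c′<g (n<2*n g)) (class-invariant (rep-class c) t)
      (subst₂ (λ X Y → X ≡ c′ + Y mod 2 * g) c′≡X 0≡Y (rep-class c′))
    where
    c<2g : c < 2 * g
    c<2g = <-trans c<g (n<2*n g)
  -- The state crosses rep c′ backwards, so its class is 2g − c′, which exceeds g.
  ... | inj₂ (1+c′+X≡2m , 1+0+Y≡2n) = contradiction c≡2g∸c′ (<⇒≢ (<-≤-trans c<g g≤2g∸c′))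
    where
    c<2g : c < 2 * g
    c<2g = <-trans c<g (n<2*n g)
    c′≤2g : c′ ≤ 2 * g
    c′≤2g = <⇒≤ (<-trans c′<g (n<2*n g))
    g≤2g∸c′ : g ≤ 2 * g ∸ c′
    g≤2g∸c′ = subst (_≤ 2 * g ∸ c′) 2g∸g≡g (∸-monoʳ-≤ (2 * g) (<⇒≤ c′<g))
    c≡2g∸c′ : c ≡ 2 * g ∸ c′
    c≡2g∸c′ = shift-unique (2 * g) c<2g (∸-monoʳ-< 0<c′ c′≤2g) (class-invariant (rep-class c) t)
      (reverse-class {X = c′} {Y = 0} 1+c′+X≡2m 1+0+Y≡2n (rep-class c′) (c+[2g∸c]≡0 c′≤2g))

  class-split : ∀ {c} → c < 2 * g → ¬ g ∣ c → (0 < c × c < g) ⊎ (g < c)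
  class-split {c} c<2g g∤c with <-cmp c g
  ... | tri< c<g _ _ = inj₁ (n≢0⇒n>0 (λ c≡0 → g∤c (subst (g ∣_) (sym c≡0) (g ∣0))) , c<g)
  ... | tri≈ _ c≡g _ = contradiction (subst (g ∣_) (sym c≡g) ∣-refl) g∤c
  ... | tri> _ _ g<c = inj₂ g<c

  rep-covers : ∀ {d} → IsDiagonal m n d → OnClosedPath m n d →
               ∃ λ c → 0 < c × c < g × SameTrajectory m n (rep c) d
  rep-covers {d} isDiagonal closed =
    let X , Y , u = unfolded²-start d isDiagonal
        c , c<2g , X≡c+Y = shift-exists (2 * g) X Y
    in covers u X≡c+Y c<2g (g ∣? c)
    where
    covers : ∀ {X Y c} → Unfolded² m n X Y (start d) → X ≡ c + Y mod 2 * g → c < 2 * g →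
             Dec (g ∣ c) → ∃ λ c → 0 < c × c < g × SameTrajectory m n (rep c) d
    covers u X≡c+Y _ (yes g∣c) = contradiction closed (g∣class⇒¬closed u X≡c+Y g∣c)
    covers {c = c} u X≡c+Y c<2g (no g∤c) with class-split c<2g g∤c
    ... | inj₁ (0<c , c<g) =
      c , 0<c , c<g ,
      subst (SameTrajectory m n (rep c)) (diagonalOf-start d) (rep-reaches c<g u X≡c+Y)
    -- Above g, the reverse state, which crosses d too, has class 2g − c below g.
    ... | inj₂ g<c =
      let X′ , Y′ , 1+X+X′≡2m , 1+Y+Y′≡2n , u′ = unfolded²-reverse (start d) u
          c′<g = subst (2 * g ∸ c <_) 2g∸g≡g (∸-monoʳ-< g<c (<⇒≤ c<2g))
          X′≡c′+Y′ = reverse-class {c′ = 2 * g ∸ c} 1+X+X′≡2m 1+Y+Y′≡2n X≡c+Y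
                                   (c+[2g∸c]≡0 (<⇒≤ c<2g))
      in 2 * g ∸ c , m<n⇒0<n∸m c<2g , c′<g ,
         subst (SameTrajectory m n (rep (2 * g ∸ c)))
               (trans (diagonalOf-reverse (start d)) (diagonalOf-start d))
               (rep-reaches c′<g u′ X′≡c′+Y′)

  closed-path-count : ClosedPathCount m n (g ∸ 1)
  closed-path-count =
    rep ∘ index ,
    (λ a → rep-isDiagonal (index<g a) , rep-closed z<s (index<g a)) ,
    (λ a b same →
      toℕ-injective (suc-injective (rep-distinct (index<g a) z<s (index<g b) same))) ,
    λ d isDiagonal closed →
      let c , 0<c , c<g , same = rep-covers isDiagonal closed
      in fromℕ< (∸-monoˡ-< c<g 0<c) ,
         subst (λ c → SameTrajectory m n (rep c) d)
               (sym (trans (cong suc (toℕ-fromℕ< _)) (m+[n∸m]≡n 0<c))) same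
    where
    index : Fin (g ∸ 1) → ℕ
    index a = suc (toℕ a)
    index<g : ∀ a → index a < g
    index<g a = subst (index a <_) (m+[n∸m]≡n (>-nonZero⁻¹ g)) (s≤s (toℕ<n a))

theorem1p3 : ∀ m n → 1 ≤ m → 1 ≤ n → ClosedPathCount m n (gcd m n ∸ 1)
theorem1p3 m n 1≤m 1≤n = closed-path-count
  where open ClosedPaths m n {{>-nonZero 1≤m}} {{>-nonZero 1≤n}}
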